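{- Let $\alpha,\beta\in\overline{\mathbb{Q}}^\times$ and let $$F_1=X_1^2+X_2^2+X_3^2-\alpha X_0^2,\qquad F_2=X_1^4+X_2^4+X_3^4-\beta X_0^4$$ in $\overline{\mathbb{Q}}[X_0,X_1,X_2,X_3]$. Then $\{F_1,F_2\}$ is a nonsingular system if and only if $\alpha^2\notin\{\beta,2\beta,3\beta\}$.
   Context: A set $\{F_1,\dots,F_r\}$ of homogeneous polynomials in $\overline{\mathbb{Q}}[X_0,\dots,X_n]$ is a nonsingular system if the Jacobian matrix $\big(\partial F_i/\partial X_j(\mathbf{x})\big)_{1\le i\le r,\,0\le j\le n}$ has rank $r$ at every nonzero $\mathbf{x}\in\overline{\mathbb{Q}}^{n+1}$ with $F_1(\mathbf{x})=\dots=F_r(\mathbf{x})=0$. -}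

module Defs where

open import Level using (_⊔_)
open import Algebra.Bundles using (CommutativeRing)
open import Data.Nat using (ℕ; zero; suc)
open import Data.Integer using (ℤ; +_; -[1+_])
open import Data.Fin using (Fin; zero; suc; _≟_)
open import Data.List using (List; []; _∷_; map; _∷ʳ_)
open import Data.List.Relation.Unary.Any using (Any)
open import Data.Product using (Σ; ∃; _×_)
open import Data.Sum using (_⊎_)
open import Relation.Nullary using (¬_; yes; no)
open import Relation.Binary.PropositionalEquality using (_≡_)

module _ {c ℓ} (R : CommutativeRing c ℓ) where
  open CommutativeRing R using (_≈_; _+_; _*_; -_; 0#; 1#) renaming (Carrier to K)

  ℕ→K : ℕ → K
  ℕ→K zero    = 0#
  ℕ→K (suc n) = 1# + ℕ→K n

  ℤ→K : ℤ → K
  ℤ→K (+ n)      = ℕ→K n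
  ℤ→K -[1+ n ]   = - ℕ→K (suc n)

  -- univariate polynomials as coefficient lists a₀ ∷ a₁ ∷ … (Horner evaluation)
  evalU : List K → K → K
  evalU []       x = 0#
  evalU (a ∷ as) x = a + x * evalU as x

  IsField : Set (c ⊔ ℓ)
  IsField = (¬ 1# ≈ 0#) × (∀ x → ¬ x ≈ 0# → ∃ λ y → x * y ≈ 1#)

  CharZero : Set ℓ
  CharZero = ∀ n → ¬ ℕ→K (suc n) ≈ 0#

  -- every polynomial of degree ≥ 1 (nonzero leading coefficient a) has a root
  AlgebraicallyClosed : Set (c ⊔ ℓ)
  AlgebraicallyClosed =
    ∀ (a₀ : K) (as : List K) (a : K) → ¬ a ≈ 0# →
    ∃ λ x → evalU ((a₀ ∷ as) ∷ʳ a) x ≈ 0#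

  -- x is a root of a nonzero polynomial with integer (equivalently rational) coefficients
  AlgebraicOverℚ : K → Set ℓ
  AlgebraicOverℚ x =
    Σ (List ℤ) λ cs → Any (λ z → ¬ z ≡ + 0) cs × evalU (map ℤ→K cs) x ≈ 0#

  -- K is an algebraic closure of ℚ (i.e. a model of ℚ̄, unique up to isomorphism)
  record IsAlgebraicClosureOfℚ : Set (c ⊔ ℓ) where
    field
      isField     : IsField
      charZero    : CharZero
      algClosed   : AlgebraicallyClosed
      algebraic   : ∀ x → AlgebraicOverℚ x

  data Poly (m : ℕ) : Set c where
    var : Fin m → Poly m
    con : K → Poly m
    _⊕_ : Poly m → Poly m → Poly m
    _⊗_ : Poly m → Poly m → Poly m

  eval : ∀ {m} → Poly m → (Fin m → K) → K
  eval (var j) x = x j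
  eval (con a) x = a
  eval (p ⊕ q) x = eval p x + eval q x
  eval (p ⊗ q) x = eval p x * eval q x

  ∂ : ∀ {m} → Fin m → Poly m → Poly m
  ∂ i (var j) with i ≟ j
  ... | yes _ = con 1#
  ... | no  _ = con 0#
  ∂ i (con a) = con 0#
  ∂ i (p ⊕ q) = ∂ i p ⊕ ∂ i q
  ∂ i (p ⊗ q) = (∂ i p ⊗ q) ⊕ (p ⊗ ∂ i q)

  _^^_ : ∀ {m} → Poly m → ℕ → Poly m
  p ^^ zero  = con 1#
  p ^^ suc k = p ⊗ (p ^^ k)

  ΣFin : ∀ {r} → (Fin r → K) → K
  ΣFin {zero}  f = 0#
  ΣFin {suc r} f = f zero + ΣFin (λ i → f (suc i))

  -- an r × m matrix has rank r iff its r rows are linearly independent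
  HasRank : ∀ {r m} → (Fin r → Fin m → K) → Set (c ⊔ ℓ)
  HasRank {r} {m} M =
    ∀ (λs : Fin r → K) → (∀ j → ΣFin (λ i → λs i * M i j) ≈ 0#) → ∀ i → λs i ≈ 0#

  NonsingularSystem : ∀ {r} (n : ℕ) → (Fin r → Poly (suc n)) → Set (c ⊔ ℓ)
  NonsingularSystem n F =
    ∀ (x : Fin (suc n) → K) → ¬ (∀ j → x j ≈ 0#) → (∀ i → eval (F i) x ≈ 0#) →
    HasRank (λ i j → eval (∂ j (F i)) x)

  X : Fin 4 → Poly 4
  X = var

  F₁ : K → Poly 4
  F₁ α = (X (suc zero) ^^ 2) ⊕ ((X (suc (suc zero)) ^^ 2) ⊕ ((X (suc (suc (suc zero))) ^^ 2)
         ⊕ (con (- α) ⊗ (X zero ^^ 2))))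

  F₂ : K → Poly 4
  F₂ β = (X (suc zero) ^^ 4) ⊕ ((X (suc (suc zero)) ^^ 4) ⊕ ((X (suc (suc (suc zero))) ^^ 4)
         ⊕ (con (- β) ⊗ (X zero ^^ 4))))

  system : K → K → Fin 2 → Poly 4
  system α β zero       = F₁ α
  system α β (suc zero) = F₂ β

  Nonzero : K → Set ℓ
  Nonzero a = ¬ a ≈ 0#

  SqInSet : K → K → Set ℓ
  SqInSet α β = (α * α ≈ β) ⊎ ((α * α ≈ ℕ→K 2 * β) ⊎ (α * α ≈ ℕ→K 3 * β))

{-# OPTIONS --safe #-}
-- The Jacobian of {F₁, F₂} drops rank at a common zero x exactly when all its 2 × 2 minors
-- vanish.  If x₀ ≠ 0, the minors (0, k) say that each α xₖ² is 0 or β x₀²; multiplying F₁ by α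
-- then gives α² x₀² = n β x₀², where n ≤ 3 counts the nonzero terms, and n = 0 is ruled out by
-- α ≠ 0.  If x₀ = 0, F₁, F₂ and the minors (j, k) with j, k ≥ 1 make every xₖ² a root of
-- t³ − e₃, with e₃ annihilated by each xₖ², so x = 0.  Conversely, if α² = (1 + ε₂ + ε₃) β with
-- ε₂, ε₃ ∈ {0, 1}, then the point (x₀, 1, ε₂, ε₃) with β x₀² = α lies on both quadrics and
-- 2 ∇F₁ = ∇F₂ there.
--
-- Equality in K is undecidable, so "λ ≈ 0" cannot be reached by a case split on the minors.
-- Instead, an element b algebraic over ℚ has a positively computable indicator e of b ≈ 0; if λ
-- kills finitely many elements b, not all of them zero, then λ (1 − ∏ e) = 0 while 1 − ∏ e is
-- invertible.
module Submission where

open import Defs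
open import Algebra.Bundles using (CommutativeRing)
open import Algebra.Solver.Ring.AlmostCommutativeRing
  using (_-Raw-AlmostCommutative⟶_; fromCommutativeRing)
import Algebra.Properties.CommutativeSemigroup as CommutativeSemigroupProperties
import Algebra.Properties.Ring as RingProperties
import Algebra.Properties.Semiring.Exp as SemiringExponentiation
import Algebra.Properties.Semiring.Mult.TCOptimised as SemiringMultiplication
import Algebra.Solver.Ring as RingSolver
open import Data.Empty using (⊥; ⊥-elim)
open import Data.Fin.Base using (Fin; zero; suc; remQuot; combine)
open import Data.Fin.Properties using (remQuot-combine)
open import Data.Integer.Base as ℤ using (ℤ; +_; -[1+_]; _⊖_)
import Data.Integer.Properties as ℤ
open import Data.List.Base as List using (_∷_)
open import Data.List.Relation.Unary.Any using (Any; here; there)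
open import Data.Maybe.Base as Maybe using ()
open import Data.Nat.Base as ℕ using (ℕ; zero; suc)
import Data.Nat.Properties as ℕ
open import Data.Product.Base using (∃; _×_; _,_; proj₁; proj₂; uncurry)
open import Data.Sum.Base using (_⊎_; inj₁; inj₂)
open import Function.Base using (_∘_)
open import Function.Bundles using (_⇔_; mk⇔)
open import Level using (_⊔_)
open import Relation.Binary.Consequences using (dec⇒weaklyDec)
open import Relation.Binary.Definitions using (WeaklyDecidable)
open import Relation.Binary.PropositionalEquality.Core as ≡ using (_≡_)
open import Relation.Nullary using (¬_)
open import Relation.Nullary.Decidable.Core using (yes; no; ¬¬-excluded-middle)

¬¬-pull-Fin : ∀ {n p} {P : Fin n → Set p} → (∀ i → ¬ ¬ P i) → ¬ ¬ (∀ i → P i)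
¬¬-pull-Fin {zero}  _   ¬∀P = ¬∀P λ ()
¬¬-pull-Fin {suc n} ¬¬P ¬∀P =
  ¬¬P zero λ P₀ → ¬¬-pull-Fin (¬¬P ∘ suc) λ P₊ → ¬∀P λ { zero → P₀ ; (suc i) → P₊ i }

module _ {r ℓ} (R : CommutativeRing r ℓ) where
  open CommutativeRing R hiding (zero) renaming (Carrier to K)
  open RingProperties ring
  open SemiringMultiplication semiring using (1+×; ×-homo-+; ×1-homo-*) renaming (_×_ to _×′_)
  open SemiringExponentiation semiring using (_^_)
  open CommutativeSemigroupProperties +-commutativeSemigroup using (interchange; x∙yz≈y∙xz)
  open import Relation.Binary.Reasoning.Setoid setoid

  -- Integers in a commutative ring

  -- ℕ→K sends 1 to 1# + 0#, whereas fromℕ sends it to 1# on the nose; interpreting the ring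
  -- solver's integer constants by fromℤ therefore lets solver goals mention 1# itself.
  fromℕ : ℕ → K
  fromℕ n = n ×′ 1#

  fromℤ : ℤ → K
  fromℤ (+ n)    = fromℕ n
  fromℤ -[1+ n ] = - fromℕ (suc n)

  ℕ→K≈fromℕ : ∀ n → ℕ→K R n ≈ fromℕ n
  ℕ→K≈fromℕ zero    = refl
  ℕ→K≈fromℕ (suc n) = trans (+-congˡ (ℕ→K≈fromℕ n)) (sym (1+× n 1#))

  fromℕ-suc : ∀ n → fromℕ (suc n) ≈ 1# + fromℕ n
  fromℕ-suc n = 1+× n 1#

  fromℕ-+ : ∀ m n → fromℕ (m ℕ.+ n) ≈ fromℕ m + fromℕ n
  fromℕ-+ = ×-homo-+ 1#

  fromℤ-⊖ : ∀ m n → fromℤ (m ⊖ n) ≈ fromℕ m - fromℕ n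
  fromℤ-⊖ m       zero    = begin
    fromℕ m          ≈⟨ +-identityʳ _ ⟨
    fromℕ m + 0#     ≈⟨ +-congˡ -0#≈0# ⟨
    fromℕ m - 0#     ∎
  fromℤ-⊖ zero    (suc n) = sym (+-identityˡ _)
  fromℤ-⊖ (suc m) (suc n) rewrite ℤ.[1+m]⊖[1+n]≡m⊖n m n = begin
    fromℤ (m ⊖ n)                       ≈⟨ fromℤ-⊖ m n ⟩
    fromℕ m - fromℕ n                   ≈⟨ +-identityˡ _ ⟨
    0# + (fromℕ m - fromℕ n)            ≈⟨ +-congʳ (-‿inverseʳ 1#) ⟨
    (1# - 1#) + (fromℕ m - fromℕ n)     ≈⟨ interchange 1# (- 1#) _ _ ⟩
    (1# + fromℕ m) + (- 1# - fromℕ n)   ≈⟨ +-congˡ (-‿+-comm 1# _) ⟩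
    (1# + fromℕ m) - (1# + fromℕ n)     ≈⟨ +-cong (fromℕ-suc m) (-‿cong (fromℕ-suc n)) ⟨
    fromℕ (suc m) - fromℕ (suc n)       ∎

  fromℤ-+ : ∀ i j → fromℤ (i ℤ.+ j) ≈ fromℤ i + fromℤ j
  fromℤ-+ -[1+ m ] -[1+ n ] = begin
    - fromℕ (suc (suc m ℕ.+ n))          ≈⟨ -‿cong (fromℕ-suc (suc m ℕ.+ n)) ⟩
    - (1# + fromℕ (suc m ℕ.+ n))         ≈⟨ -‿cong (+-congˡ (fromℕ-+ (suc m) n)) ⟩
    - (1# + (fromℕ (suc m) + fromℕ n))   ≈⟨ -‿cong (x∙yz≈y∙xz 1# _ _) ⟩
    - (fromℕ (suc m) + (1# + fromℕ n))   ≈⟨ -‿cong (+-congˡ (fromℕ-suc n)) ⟨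
    - (fromℕ (suc m) + fromℕ (suc n))    ≈⟨ -‿+-comm _ _ ⟨
    fromℤ -[1+ m ] + fromℤ -[1+ n ]      ∎
  fromℤ-+ -[1+ m ] (+ n)    = trans (fromℤ-⊖ n (suc m)) (+-comm _ _)
  fromℤ-+ (+ m)    -[1+ n ] = fromℤ-⊖ m (suc n)
  fromℤ-+ (+ m)    (+ n)    = fromℕ-+ m n

  fromℤ-neg : ∀ i → fromℤ (ℤ.- i) ≈ - fromℤ i
  fromℤ-neg (+ zero)  = sym -0#≈0#
  fromℤ-neg (+ suc n) = refl
  fromℤ-neg -[1+ n ]  = sym (-‿involutive _)

  fromℤ-*-pos : ∀ m j → fromℤ (+ m ℤ.* j) ≈ fromℕ m * fromℤ j
  fromℤ-*-pos m (+ n)    rewrite ≡.sym (ℤ.pos-* m n) = ×1-homo-* m n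
  fromℤ-*-pos m -[1+ n ] = begin
    fromℤ (+ m ℤ.* -[1+ n ])        ≡⟨ ≡.cong fromℤ (ℤ.neg-distribʳ-* (+ m) (+ suc n)) ⟨
    fromℤ (ℤ.- (+ m ℤ.* + suc n))   ≈⟨ fromℤ-neg (+ m ℤ.* + suc n) ⟩
    - fromℤ (+ m ℤ.* + suc n)       ≈⟨ -‿cong (fromℤ-*-pos m (+ suc n)) ⟩
    - (fromℕ m * fromℕ (suc n))     ≈⟨ -‿distribʳ-* _ _ ⟩
    fromℕ m * fromℤ -[1+ n ]        ∎

  fromℤ-* : ∀ i j → fromℤ (i ℤ.* j) ≈ fromℤ i * fromℤ j
  fromℤ-* (+ m)    j = fromℤ-*-pos m j
  fromℤ-* -[1+ m ] j = begin
    fromℤ (-[1+ m ] ℤ.* j)          ≡⟨ ≡.cong fromℤ (ℤ.neg-distribˡ-* (+ suc m) j) ⟨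
    fromℤ (ℤ.- (+ suc m ℤ.* j))     ≈⟨ fromℤ-neg (+ suc m ℤ.* j) ⟩
    - fromℤ (+ suc m ℤ.* j)         ≈⟨ -‿cong (fromℤ-*-pos (suc m) j) ⟩
    - (fromℕ (suc m) * fromℤ j)     ≈⟨ -‿distribˡ-* _ _ ⟩
    fromℤ -[1+ m ] * fromℤ j        ∎

  fromℤ-morphism : ℤ.+-*-rawRing -Raw-AlmostCommutative⟶ fromCommutativeRing R
  fromℤ-morphism = record
    { ⟦_⟧    = fromℤ
    ; +-homo = fromℤ-+
    ; *-homo = fromℤ-*
    ; -‿homo = fromℤ-neg
    ; 0-homo = refl
    ; 1-homo = refl
    }

  fromℤ-≟ : WeaklyDecidable (λ i j → fromℤ i ≈ fromℤ j)
  fromℤ-≟ i j = Maybe.map (λ { ≡.refl → refl }) (dec⇒weaklyDec ℤ._≟_ i j)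

  module Solver = RingSolver ℤ.+-*-rawRing (fromCommutativeRing R) fromℤ-morphism fromℤ-≟
  open Solver using (Polynomial; solve; _:=_; _:+_; _:*_; _:-_; :-_; _:^_)

  κ : ∀ {n} → ℕ → Polynomial n
  κ k = Solver.con (+ k)

  *-≈0ʳ : ∀ a {b} → b ≈ 0# → a * b ≈ 0#
  *-≈0ʳ a b≈0 = trans (*-congˡ b≈0) (zeroʳ a)

  +-≈0 : ∀ {a b} → a ≈ 0# → b ≈ 0# → a + b ≈ 0#
  +-≈0 a≈0 b≈0 = trans (+-cong a≈0 b≈0) (+-identityʳ 0#)

  idempotent-^ : ∀ {ε} → ε * ε ≈ ε → ∀ n → ε ^ suc n ≈ ε
  idempotent-^ εε≈ε zero    = *-identityʳ _
  idempotent-^ εε≈ε (suc n) = trans (*-congˡ (idempotent-^ εε≈ε n)) εε≈ε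

  0∨s⇒multiple : ∀ {x s} → x ≈ 0# ⊎ x ≈ s → ∃ λ n → n ℕ.≤ 1 × x ≈ fromℕ n * s
  0∨s⇒multiple {s = s} (inj₁ x≈0) = 0 , ℕ.z≤n , trans x≈0 (sym (zeroˡ s))
  0∨s⇒multiple {s = s} (inj₂ x≈s) = 1 , ℕ.s≤s ℕ.z≤n , trans x≈s (sym (*-identityˡ s))

  multiple-+ : ∀ m n {x y s} → x ≈ fromℕ m * s → y ≈ fromℕ n * s → x + y ≈ fromℕ (m ℕ.+ n) * s
  multiple-+ m n {s = s} x≈ms y≈ns = begin
    _ + _                        ≈⟨ +-cong x≈ms y≈ns ⟩
    fromℕ m * s + fromℕ n * s    ≈⟨ distribʳ s _ _ ⟨
    (fromℕ m + fromℕ n) * s      ≈⟨ *-congʳ (fromℕ-+ m n) ⟨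
    fromℕ (m ℕ.+ n) * s          ∎

  -- Derivatives of polynomials

  eval-^^ : ∀ {m} (p : Poly R m) n x → eval R (_^^_ R p n) x ≡ eval R p x ^ n
  eval-^^ p zero    x = ≡.refl
  eval-^^ p (suc n) x = ≡.cong (eval R p x *_) (eval-^^ p n x)

  eval-∂-^^ : ∀ {m} i (p : Poly R m) n x →
              eval R (∂ R i (_^^_ R p (suc n))) x ≈ fromℕ (suc n) * (eval R p x ^ n * eval R (∂ R i p) x)
  eval-∂-^^ i p zero    x =
    solve 2 (λ p′ d → d :* κ 1 :+ p′ :* κ 0 := κ 1 :* (κ 1 :* d)) refl (eval R p x) (eval R (∂ R i p) x)
  eval-∂-^^ i p (suc n) x = begin
    d * eval R (_^^_ R p (suc n)) x + p′ * eval R (∂ R i (_^^_ R p (suc n))) x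
      ≈⟨ +-cong (*-congˡ (reflexive (eval-^^ p (suc n) x))) (*-congˡ (eval-∂-^^ i p n x)) ⟩
    d * (p′ * p′ ^ n) + p′ * (fromℕ (suc n) * (p′ ^ n * d))
      ≈⟨ solve 4 (λ p′ q d N → d :* (p′ :* q) :+ p′ :* (N :* (q :* d)) := (N :+ κ 1) :* (p′ :* q :* d))
               refl p′ (p′ ^ n) d (fromℕ (suc n)) ⟩
    fromℕ (suc (suc n)) * (p′ ^ suc n * d)
      ∎
    where
    p′ d : K
    p′ = eval R p x
    d  = eval R (∂ R i p) x

  -- F₁ α and F₂ β are, definitionally, diagonal 2 α and diagonal 4 β.
  diagonal : ℕ → K → Poly R 4
  diagonal d c = xᵈ (suc zero) ⊕ (xᵈ (suc (suc zero)) ⊕ (xᵈ (suc (suc (suc zero))) ⊕ (con (- c) ⊗ xᵈ zero)))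
    where
    xᵈ : Fin 4 → Poly R 4
    xᵈ j = _^^_ R (X R j) d

  weight : K → Fin 4 → K
  weight c zero    = - c
  weight c (suc _) = 1#

  ∂-diagonal : ∀ d c x j → eval R (∂ R j (diagonal (suc d) c)) x ≈ fromℕ (suc d) * (weight c j * x j ^ d)
  ∂-diagonal d c x j = trans (expand j) (collapse j)
    where
    N Q : K
    N = fromℕ (suc d)
    Q = eval R (_^^_ R (X R zero) (suc d)) x
    j₁ j₂ j₃ : Fin 4
    j₁ = suc zero
    j₂ = suc (suc zero)
    j₃ = suc (suc (suc zero))
    δ : Fin 4 → Fin 4 → K
    δ j k = eval R (∂ R j (X R k)) x

    expanded : ∀ {n} (δ₀ δ₁ δ₂ δ₃ N c P₀ P₁ P₂ P₃ Q : Polynomial n) → Polynomial n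
    expanded δ₀ δ₁ δ₂ δ₃ N c P₀ P₁ P₂ P₃ Q =
      N :* (P₁ :* δ₁) :+ (N :* (P₂ :* δ₂) :+ (N :* (P₃ :* δ₃) :+ (κ 0 :* Q :+ :- c :* (N :* (P₀ :* δ₀)))))

    Expanded : Fin 4 → K
    Expanded j = N * (x j₁ ^ d * δ j j₁) + (N * (x j₂ ^ d * δ j j₂) + (N * (x j₃ ^ d * δ j j₃)
                 + (0# * Q + - c * (N * (x zero ^ d * δ j zero)))))

    expand : ∀ j → eval R (∂ R j (diagonal (suc d) c)) x ≈ Expanded j
    expand j = +-cong (eval-∂-^^ j (X R j₁) d x) (+-cong (eval-∂-^^ j (X R j₂) d x)
                 (+-cong (eval-∂-^^ j (X R j₃) d x) (+-congˡ (*-congˡ (eval-∂-^^ j (X R zero) d x)))))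

    -- Once j is concrete, each δ j k reduces to 1# or 0#, so every case is a ring identity.
    collapse : ∀ j → Expanded j ≈ N * (weight c j * x j ^ d)
    collapse zero =
      solve 7 (λ N c P₀ P₁ P₂ P₃ Q → expanded (κ 1) (κ 0) (κ 0) (κ 0) N c P₀ P₁ P₂ P₃ Q := N :* (:- c :* P₀))
            refl N c (x zero ^ d) (x j₁ ^ d) (x j₂ ^ d) (x j₃ ^ d) Q
    collapse (suc zero) =
      solve 7 (λ N c P₀ P₁ P₂ P₃ Q → expanded (κ 0) (κ 1) (κ 0) (κ 0) N c P₀ P₁ P₂ P₃ Q := N :* (κ 1 :* P₁))
            refl N c (x zero ^ d) (x j₁ ^ d) (x j₂ ^ d) (x j₃ ^ d) Q
    collapse (suc (suc zero)) =
      solve 7 (λ N c P₀ P₁ P₂ P₃ Q → expanded (κ 0) (κ 0) (κ 1) (κ 0) N c P₀ P₁ P₂ P₃ Q := N :* (κ 1 :* P₂))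
            refl N c (x zero ^ d) (x j₁ ^ d) (x j₂ ^ d) (x j₃ ^ d) Q
    collapse (suc (suc (suc zero))) =
      solve 7 (λ N c P₀ P₁ P₂ P₃ Q → expanded (κ 0) (κ 0) (κ 0) (κ 1) N c P₀ P₁ P₂ P₃ Q := N :* (κ 1 :* P₃))
            refl N c (x zero ^ d) (x j₁ ^ d) (x j₂ ^ d) (x j₃ ^ d) Q

  -- Minors of 2-row matrices

  minor : ∀ {m} → (Fin 2 → Fin m → K) → Fin m → Fin m → K
  minor M j k = M zero j * M (suc zero) k - M zero k * M (suc zero) j

  minor-cong : ∀ {m} {M M′ : Fin 2 → Fin m → K} → (∀ i j → M i j ≈ M′ i j) → ∀ j k → minor M j k ≈ minor M′ j k
  minor-cong M≈M′ j k =
    +-cong (*-cong (M≈M′ zero j) (M≈M′ (suc zero) k)) (-‿cong (*-cong (M≈M′ zero k) (M≈M′ (suc zero) j)))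

  cramer : ∀ {m} (M : Fin 2 → Fin m → K) (λs : Fin 2 → K) →
           (∀ j → ΣFin R (λ i → λs i * M i j) ≈ 0#) → ∀ i j k → λs i * minor M j k ≈ 0#
  cramer M λs λM≈0 zero j k = trans
    (solve 6 (λ l₀ l₁ a b a′ b′ → l₀ :* (a :* b′ :- a′ :* b) :=
                b′ :* (l₀ :* a :+ (l₁ :* b :+ κ 0)) :+ :- b :* (l₀ :* a′ :+ (l₁ :* b′ :+ κ 0)))
           refl (λs zero) (λs (suc zero)) (M zero j) (M (suc zero) j) (M zero k) (M (suc zero) k))
    (+-≈0 (*-≈0ʳ _ (λM≈0 j)) (*-≈0ʳ _ (λM≈0 k)))
  cramer M λs λM≈0 (suc zero) j k = trans
    (solve 6 (λ l₀ l₁ a b a′ b′ → l₁ :* (a :* b′ :- a′ :* b) :=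
                a :* (l₀ :* a′ :+ (l₁ :* b′ :+ κ 0)) :+ :- a′ :* (l₀ :* a :+ (l₁ :* b :+ κ 0)))
           refl (λs zero) (λs (suc zero)) (M zero j) (M (suc zero) j) (M zero k) (M (suc zero) k))
    (+-≈0 (*-≈0ʳ _ (λM≈0 k)) (*-≈0ʳ _ (λM≈0 j)))

  module _ (isField : IsField R) where

    x≉0∧xy≈0⇒y≈0 : ∀ {x y} → ¬ x ≈ 0# → x * y ≈ 0# → y ≈ 0#
    x≉0∧xy≈0⇒y≈0 {x} {y} x≉0 xy≈0 with proj₂ isField x x≉0
    ... | x⁻¹ , xx⁻¹≈1 = begin
      y              ≈⟨ *-identityˡ y ⟨
      1# * y         ≈⟨ *-congʳ xx⁻¹≈1 ⟨
      x * x⁻¹ * y    ≈⟨ solve 3 (λ x x⁻¹ y → x :* x⁻¹ :* y := x⁻¹ :* (x :* y)) refl x x⁻¹ y ⟩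
      x⁻¹ * (x * y)  ≈⟨ *-≈0ʳ x⁻¹ xy≈0 ⟩
      0#             ∎

    x≉0∧y≉0⇒xy≉0 : ∀ {x y} → ¬ x ≈ 0# → ¬ y ≈ 0# → ¬ x * y ≈ 0#
    x≉0∧y≉0⇒xy≉0 x≉0 y≉0 xy≈0 = y≉0 (x≉0∧xy≈0⇒y≈0 x≉0 xy≈0)

    x^n≈0⇒¬¬x≈0 : ∀ {x} n → x ^ n ≈ 0# → ¬ ¬ x ≈ 0#
    x^n≈0⇒¬¬x≈0 zero    1≈0    _   = proj₁ isField 1≈0
    x^n≈0⇒¬¬x≈0 (suc n) xⁿ⁺¹≈0 x≉0 = x^n≈0⇒¬¬x≈0 n (x≉0∧xy≈0⇒y≈0 x≉0 xⁿ⁺¹≈0) x≉0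

    x[x-s]≈0⇒¬¬[x≈0∨x≈s] : ∀ {x s} → x * (x - s) ≈ 0# → ¬ ¬ (x ≈ 0# ⊎ x ≈ s)
    x[x-s]≈0⇒¬¬[x≈0∨x≈s] {x} {s} x[x-s]≈0 ¬[x≈0∨x≈s] = ¬¬-excluded-middle λ
      { (yes x≈0) → ¬[x≈0∨x≈s] (inj₁ x≈0)
      ; (no x≉0)  → ¬[x≈0∨x≈s] (inj₂ (x∙y⁻¹≈ε⇒x≈y x s (x≉0∧xy≈0⇒y≈0 x≉0 x[x-s]≈0)))
      }

    square-multiple⇒SqInSet : ∀ {α β} → ¬ α ≈ 0# → ∀ n → n ℕ.≤ 3 → α * α ≈ fromℕ n * β → SqInSet R α β
    square-multiple⇒SqInSet {β = β} α≉0 0 _ α²≈0 =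
      ⊥-elim (x≉0∧y≉0⇒xy≉0 α≉0 α≉0 (trans α²≈0 (zeroˡ β)))
    square-multiple⇒SqInSet {β = β} _ 1 _ α²≈β  = inj₁ (trans α²≈β (*-identityˡ β))
    square-multiple⇒SqInSet _ 2 _ α²≈2β = inj₂ (inj₁ (trans α²≈2β (*-congʳ (sym (ℕ→K≈fromℕ 2)))))
    square-multiple⇒SqInSet _ 3 _ α²≈3β = inj₂ (inj₂ (trans α²≈3β (*-congʳ (sym (ℕ→K≈fromℕ 3)))))
    square-multiple⇒SqInSet _ (suc (suc (suc (suc _)))) (ℕ.s≤s (ℕ.s≤s (ℕ.s≤s ())))

  module _ (isField : IsField R) (charZero : CharZero R) where

    fromℕ[1+n]≉0 : ∀ n → ¬ fromℕ (suc n) ≈ 0#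
    fromℕ[1+n]≉0 n h = charZero n (trans (ℕ→K≈fromℕ (suc n)) h)

    fourth-powers-vanish : ∀ {a b c} → a + b + c ≈ 0# → a ^ 2 + b ^ 2 + c ^ 2 ≈ 0# →
      a * b * (b - a) ≈ 0# → a * c * (c - a) ≈ 0# → b * c * (c - b) ≈ 0# →
      a ^ 4 ≈ 0# × b ^ 4 ≈ 0# × c ^ 4 ≈ 0#
    fourth-powers-vanish {a} {b} {c} s₁≈0 s₂≈0 tab≈0 tac≈0 tbc≈0 =
        cancel₆ (trans
          (solve 3 (λ a b c → κ 6 :* a :^ 4 := cofactor a b c a :* (a :+ b :+ c)
                      :+ κ 3 :* a :^ 2 :* (a :^ 2 :+ b :^ 2 :+ c :^ 2)
                      :+ :- (κ 2 :* c) :* (a :* b :* (b :- a)) :+ :- (κ 2 :* b) :* (a :* c :* (c :- a)))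
                 refl a b c)
          (vanishes tab≈0 tac≈0))
      , cancel₆ (trans
          (solve 3 (λ a b c → κ 6 :* b :^ 4 := cofactor a b c b :* (a :+ b :+ c)
                      :+ κ 3 :* b :^ 2 :* (a :^ 2 :+ b :^ 2 :+ c :^ 2)
                      :+ κ 2 :* c :* (a :* b :* (b :- a)) :+ :- (κ 2 :* a) :* (b :* c :* (c :- b)))
                 refl a b c)
          (vanishes tab≈0 tbc≈0))
      , cancel₆ (trans
          (solve 3 (λ a b c → κ 6 :* c :^ 4 := cofactor a b c c :* (a :+ b :+ c)
                      :+ κ 3 :* c :^ 2 :* (a :^ 2 :+ b :^ 2 :+ c :^ 2)
                      :+ κ 2 :* b :* (a :* c :* (c :- a)) :+ κ 2 :* a :* (b :* c :* (c :- b)))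
                 refl a b c)
          (vanishes tac≈0 tbc≈0))
      where
      cancel₆ : ∀ {y} → fromℕ 6 * y ≈ 0# → y ≈ 0#
      cancel₆ = x≉0∧xy≈0⇒y≈0 isField (fromℕ[1+n]≉0 5)

      vanishes : ∀ {p q u v t t′} → t ≈ 0# → t′ ≈ 0# →
                 p * (a + b + c) + q * (a ^ 2 + b ^ 2 + c ^ 2) + u * t + v * t′ ≈ 0#
      vanishes t≈0 t′≈0 = +-≈0 (+-≈0 (+-≈0 (*-≈0ʳ _ s₁≈0) (*-≈0ʳ _ s₂≈0)) (*-≈0ʳ _ t≈0)) (*-≈0ʳ _ t′≈0)

      -- Each y ∈ {a, b, c} is a root of t³ − e₁t² + e₂t − e₃, so y⁴ = e₁y³ − e₂y² + e₃y; then
      -- 2e₂ = e₁² − s₂, and 3e₃y = e₃e₁ minus multiples of the two pair terms containing y.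
      cofactor : Polynomial 3 → Polynomial 3 → Polynomial 3 → Polynomial 3 → Polynomial 3
      cofactor a b c y = κ 6 :* y :^ 3 :- κ 3 :* ((a :+ b :+ c) :* y :^ 2) :+ κ 2 :* (a :* b :* c)

  -- Zero indicators and the rank of a 2-row matrix

  -- e plays the role of the characteristic function of b ≈ 0: it is killed by a power of b
  -- and is ≡ 1 modulo b.
  record ZeroIndicator (b : K) : Set (r ⊔ ℓ) where
    field
      e w    : K
      m      : ℕ
      e*bᵐ≈0 : e * b ^ m ≈ 0#
      e+bw≈1 : e + b * w ≈ 1#

  module _ (isField : IsField R) (charZero : CharZero R) (algebraic : ∀ x → AlgebraicOverℚ R x) where

    ℤ→K≉0 : ∀ {z} → ¬ z ≡ + 0 → ¬ ℤ→K R z ≈ 0#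
    ℤ→K≉0 {+ zero}   z≢0 _ = z≢0 ≡.refl
    ℤ→K≉0 {+ suc n}  _     = charZero n
    ℤ→K≉0 { -[1+ n ] } _ h = charZero n (-‿injective (trans h (sym -0#≈0#)))

    lowest-term : ∀ b cs → Any (λ z → ¬ z ≡ + 0) cs →
      ∃ λ m → ∃ λ C → ∃ λ r → ¬ C ≈ 0# × evalU R (List.map (ℤ→K R) cs) b ≈ b ^ m * (C + b * r)
    lowest-term b (z ∷ cs) _ with z ℤ.≟ + 0
    lowest-term b (z ∷ cs) _            | no z≢0 =
      0 , ℤ→K R z , evalU R (List.map (ℤ→K R) cs) b , ℤ→K≉0 z≢0 , sym (*-identityˡ _)
    lowest-term b (z ∷ cs) (here z≢0)   | yes z≡0 = ⊥-elim (z≢0 z≡0)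
    lowest-term b (z ∷ cs) (there cs≢0) | yes ≡.refl with lowest-term b cs cs≢0
    ... | m , C , r , C≉0 , cs[b]≈ = suc m , C , r , C≉0 , (begin
      0# + b * evalU R (List.map (ℤ→K R) cs) b   ≈⟨ +-identityˡ _ ⟩
      b * evalU R (List.map (ℤ→K R) cs) b        ≈⟨ *-congˡ cs[b]≈ ⟩
      b * (b ^ m * (C + b * r))                  ≈⟨ *-assoc b _ _ ⟨
      b * b ^ m * (C + b * r)                    ∎)

    zeroIndicator : ∀ b → ZeroIndicator b
    zeroIndicator b with algebraic b
    ... | cs , cs≢0 , cs[b]≈0 with lowest-term b cs cs≢0
    ... | m , C , r , C≉0 , cs[b]≈ with proj₂ isField C C≉0
    ... | C⁻¹ , CC⁻¹≈1 = record
      { e      = C⁻¹ * (C + b * r)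
      ; w      = - (C⁻¹ * r)
      ; m      = m
      ; e*bᵐ≈0 = trans (solve 3 (λ C⁻¹ Q bᵐ → C⁻¹ :* Q :* bᵐ := C⁻¹ :* (bᵐ :* Q)) refl C⁻¹ (C + b * r) (b ^ m))
                       (*-≈0ʳ C⁻¹ (trans (sym cs[b]≈) cs[b]≈0))
      ; e+bw≈1 = trans (solve 4 (λ C⁻¹ C b r → C⁻¹ :* (C :+ b :* r) :+ b :* :- (C⁻¹ :* r) := C :* C⁻¹) refl C⁻¹ C b r)
                       CC⁻¹≈1
      }

    order : K → ℕ
    order b = ZeroIndicator.m (zeroIndicator b)

    allZeroIndicator : ∀ {n} → (Fin n → K) → K
    allZeroIndicator {zero}  b = 1#
    allZeroIndicator {suc n} b = ZeroIndicator.e (zeroIndicator (b zero)) * allZeroIndicator (λ i → b (suc i))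

    annihilator-absorbs : ∀ {n} (b : Fin n → K) {μ} → (∀ i → μ * b i ≈ 0#) → μ * allZeroIndicator b ≈ μ
    annihilator-absorbs {zero}  b {μ} _     = *-identityʳ μ
    annihilator-absorbs {suc n} b {μ} μb≈0 = begin
      μ * (e * E)            ≈⟨ solve 3 (λ μ e E → μ :* (e :* E) := μ :* E :* e) refl μ e E ⟩
      μ * E * e              ≈⟨ *-congʳ (annihilator-absorbs (λ i → b (suc i)) (λ i → μb≈0 (suc i))) ⟩
      μ * e                  ≈⟨ solve 4 (λ μ e b w → μ :* e := μ :* (e :+ b :* w) :+ :- w :* (μ :* b)) refl μ e (b zero) w ⟩
      μ * (e + b zero * w) + - w * (μ * b zero)
                             ≈⟨ +-cong (*-congˡ e+bw≈1) (*-≈0ʳ (- w) (μb≈0 zero)) ⟩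
      μ * 1# + 0#            ≈⟨ solve 1 (λ μ → μ :* κ 1 :+ κ 0 := μ) refl μ ⟩
      μ                      ∎
      where
      open ZeroIndicator (zeroIndicator (b zero))
      E : K
      E = allZeroIndicator (λ i → b (suc i))

    allZeroIndicator-kills : ∀ {n} (b : Fin n → K) i →
                             b i ^ order (b i) * allZeroIndicator b ≈ 0#
    allZeroIndicator-kills {suc n} b zero = trans
      (solve 3 (λ bᵐ e E → bᵐ :* (e :* E) := E :* (e :* bᵐ)) refl (b zero ^ m) e E)
      (*-≈0ʳ E e*bᵐ≈0)
      where
      open ZeroIndicator (zeroIndicator (b zero))
      E : K
      E = allZeroIndicator (λ i → b (suc i))
    allZeroIndicator-kills {suc n} b (suc i) = trans
      (solve 3 (λ bᵐ e E → bᵐ :* (e :* E) := e :* (bᵐ :* E)) refl (b (suc i) ^ order (b (suc i))) e E)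
      (*-≈0ʳ e (allZeroIndicator-kills (λ i → b (suc i)) i))
      where
      open ZeroIndicator (zeroIndicator (b zero))
      E : K
      E = allZeroIndicator (λ i → b (suc i))

    annihilator≈0 : ∀ {n} (b : Fin n → K) {μ} → (∀ i → μ * b i ≈ 0#) → ¬ (∀ i → b i ≈ 0#) → μ ≈ 0#
    annihilator≈0 b {μ} μb≈0 b≉0 = x≉0∧xy≈0⇒y≈0 isField 1-E≉0 (begin
      (1# - E) * μ   ≈⟨ solve 2 (λ E μ → (κ 1 :- E) :* μ := μ :- μ :* E) refl E μ ⟩
      μ - μ * E      ≈⟨ x≈y⇒x∙y⁻¹≈ε (sym (annihilator-absorbs b μb≈0)) ⟩
      0#             ∎)
      where
      E : K
      E = allZeroIndicator b

      1-E≉0 : ¬ 1# - E ≈ 0#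
      1-E≉0 1-E≈0 = ¬¬-pull-Fin (λ i → x^n≈0⇒¬¬x≈0 isField (order (b i)) (bᵐ≈0 i)) b≉0
        where
        bᵐ≈0 : ∀ i → b i ^ order (b i) ≈ 0#
        bᵐ≈0 i = trans (trans (sym (*-identityʳ _)) (*-congˡ (x∙y⁻¹≈ε⇒x≈y 1# E 1-E≈0)))
                       (allZeroIndicator-kills b i)

    hasRank₂ : ∀ {m} (M : Fin 2 → Fin m → K) → ¬ (∀ j k → minor M j k ≈ 0#) → HasRank R M
    hasRank₂ {m} M minors≉0 λs λM≈0 i =
      annihilator≈0 minors (λ p → cramer M λs λM≈0 i _ _) (λ minors≈0 → minors≉0 (minor≈0 minors≈0))
      where
      minors : Fin (m ℕ.* m) → K
      minors = uncurry (minor M) ∘ remQuot m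

      minor≈0 : (∀ p → minors p ≈ 0#) → ∀ j k → minor M j k ≈ 0#
      minor≈0 minors≈0 j k = ≡.subst (λ p → uncurry (minor M) p ≈ 0#) (remQuot-combine j k) (minors≈0 (combine j k))

  -- The Jacobian of the system

  module _ (α β : K) (x : Fin 4 → K) where

    jacobian : Fin 2 → Fin 4 → K
    jacobian i j = eval R (∂ R j (system R α β i)) x

    gradient : Fin 2 → Fin 4 → K
    gradient zero       j = fromℕ 2 * (weight α j * x j ^ 1)
    gradient (suc zero) j = fromℕ 4 * (weight β j * x j ^ 3)

    jacobian≈gradient : ∀ i j → jacobian i j ≈ gradient i j
    jacobian≈gradient zero       = ∂-diagonal 1 α x
    jacobian≈gradient (suc zero) = ∂-diagonal 3 β x

    minor-affine : ∀ k → minor jacobian zero (suc k) ≈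
                   fromℕ 8 * x zero * (x (suc k) * (β * x zero ^ 2 - α * x (suc k) ^ 2))
    minor-affine k = trans (minor-cong jacobian≈gradient zero (suc k))
      (solve 4 (λ a b x₀ xₖ → κ 2 :* (:- a :* x₀ :^ 1) :* (κ 4 :* (κ 1 :* xₖ :^ 3))
                              :- κ 2 :* (κ 1 :* xₖ :^ 1) :* (κ 4 :* (:- b :* x₀ :^ 3))
                              := κ 8 :* x₀ :* (xₖ :* (b :* x₀ :^ 2 :- a :* xₖ :^ 2)))
             refl α β (x zero) (x (suc k)))

    minor-at-infinity : ∀ j k → minor jacobian (suc j) (suc k) ≈
                        fromℕ 8 * (x (suc j) * x (suc k) * (x (suc k) ^ 2 - x (suc j) ^ 2))
    minor-at-infinity j k = trans (minor-cong jacobian≈gradient (suc j) (suc k))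
      (solve 2 (λ xⱼ xₖ → κ 2 :* (κ 1 :* xⱼ :^ 1) :* (κ 4 :* (κ 1 :* xₖ :^ 3))
                         :- κ 2 :* (κ 1 :* xₖ :^ 1) :* (κ 4 :* (κ 1 :* xⱼ :^ 3))
                         := κ 8 :* (xⱼ :* xₖ :* (xₖ :^ 2 :- xⱼ :^ 2)))
             refl (x (suc j)) (x (suc k)))

  module Singular (isField : IsField R) (charZero : CharZero R) {α β : K} (x : Fin 4 → K)
                  (F₁[x]≈0 : eval R (F₁ R α) x ≈ 0#) (F₂[x]≈0 : eval R (F₂ R β) x ≈ 0#)
                  (minors≈0 : ∀ j k → minor (jacobian α β x) j k ≈ 0#) where

    private
      cancel₈ : ∀ {y} → fromℕ 8 * y ≈ 0# → y ≈ 0#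
      cancel₈ = x≉0∧xy≈0⇒y≈0 isField (fromℕ[1+n]≉0 isField charZero 7)

    affine⇒¬¬SqInSet : ¬ α ≈ 0# → ¬ x zero ≈ 0# → ¬ ¬ SqInSet R α β
    affine⇒¬¬SqInSet α≉0 x₀≉0 ¬sq =
      dichotomy zero λ d₁ → dichotomy (suc zero) λ d₂ → dichotomy (suc (suc zero)) λ d₃ →
      counted (0∨s⇒multiple d₁) (0∨s⇒multiple d₂) (0∨s⇒multiple d₃)
      where
      S : K
      S = β * x zero ^ 2
      Y : Fin 3 → K
      Y k = α * x (suc k) ^ 2

      Y[Y-S]≈0 : ∀ k → Y k * (Y k - S) ≈ 0#
      Y[Y-S]≈0 k = trans
        (solve 4 (λ a b x₀ xₖ → a :* xₖ :^ 2 :* (a :* xₖ :^ 2 :- b :* x₀ :^ 2)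
                                := :- (a :* xₖ) :* (xₖ :* (b :* x₀ :^ 2 :- a :* xₖ :^ 2)))
               refl α β (x zero) (x (suc k)))
        (*-≈0ʳ _ (x≉0∧xy≈0⇒y≈0 isField 8x₀≉0 (trans (sym (minor-affine α β x k)) (minors≈0 zero (suc k)))))
        where
        8x₀≉0 : ¬ fromℕ 8 * x zero ≈ 0#
        8x₀≉0 = x≉0∧y≉0⇒xy≉0 isField (fromℕ[1+n]≉0 isField charZero 7) x₀≉0

      dichotomy : ∀ k → ¬ ¬ (Y k ≈ 0# ⊎ Y k ≈ S)
      dichotomy k = x[x-s]≈0⇒¬¬[x≈0∨x≈s] isField (Y[Y-S]≈0 k)

      ΣY≈α²x₀² : Y zero + Y (suc zero) + Y (suc (suc zero)) ≈ α * α * x zero ^ 2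
      ΣY≈α²x₀² = trans
        (solve 5 (λ a x₀ x₁ x₂ x₃ → a :* x₁ :^ 2 :+ a :* x₂ :^ 2 :+ a :* x₃ :^ 2
                                   := a :* (x₁ :^ 2 :+ (x₂ :^ 2 :+ (x₃ :^ 2 :+ :- a :* x₀ :^ 2))) :+ a :* a :* x₀ :^ 2)
               refl α (x zero) (x (suc zero)) (x (suc (suc zero))) (x (suc (suc (suc zero)))))
        (trans (+-congʳ (*-≈0ʳ α F₁[x]≈0)) (+-identityˡ _))

      α²≈nβ : ∀ n → α * α * x zero ^ 2 ≈ fromℕ n * S → α * α ≈ fromℕ n * β
      α²≈nβ n α²x₀²≈nS = x∙y⁻¹≈ε⇒x≈y _ _ (x≉0∧xy≈0⇒y≈0 isField x₀²≉0 (trans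
        (solve 4 (λ a b x₀ N → x₀ :^ 2 :* (a :* a :- N :* b) := a :* a :* x₀ :^ 2 :- N :* (b :* x₀ :^ 2))
               refl α β (x zero) (fromℕ n))
        (x≈y⇒x∙y⁻¹≈ε α²x₀²≈nS)))
        where
        x₀²≉0 : ¬ x zero ^ 2 ≈ 0#
        x₀²≉0 x₀²≈0 = x^n≈0⇒¬¬x≈0 isField 2 x₀²≈0 x₀≉0

      counted : (∃ λ n → n ℕ.≤ 1 × Y zero ≈ fromℕ n * S) →
                (∃ λ n → n ℕ.≤ 1 × Y (suc zero) ≈ fromℕ n * S) →
                (∃ λ n → n ℕ.≤ 1 × Y (suc (suc zero)) ≈ fromℕ n * S) → ⊥
      counted (n₁ , n₁≤1 , Y₁≈n₁S) (n₂ , n₂≤1 , Y₂≈n₂S) (n₃ , n₃≤1 , Y₃≈n₃S) =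
        ¬sq (square-multiple⇒SqInSet isField α≉0 (n₁ ℕ.+ n₂ ℕ.+ n₃) (ℕ.+-mono-≤ (ℕ.+-mono-≤ n₁≤1 n₂≤1) n₃≤1)
               (α²≈nβ (n₁ ℕ.+ n₂ ℕ.+ n₃)
                 (trans (sym ΣY≈α²x₀²) (multiple-+ (n₁ ℕ.+ n₂) n₃ (multiple-+ n₁ n₂ Y₁≈n₁S Y₂≈n₂S) Y₃≈n₃S))))

    at-infinity⇒¬¬x≈0 : x zero ≈ 0# → ¬ ¬ (∀ j → x j ≈ 0#)
    at-infinity⇒¬¬x≈0 x₀≈0 = ¬¬-pull-Fin λ
      { zero    → λ x₀≉0 → x₀≉0 x₀≈0
      ; (suc k) → x^n≈0⇒¬¬x≈0 isField 8 (x⁸≈0 k)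
      }
      where
      y : Fin 3 → K
      y k = x (suc k) ^ 2

      Σy≈0 : y zero + y (suc zero) + y (suc (suc zero)) ≈ 0#
      Σy≈0 = trans
        (solve 5 (λ a x₀ x₁ x₂ x₃ → x₁ :^ 2 :+ x₂ :^ 2 :+ x₃ :^ 2
                                   := x₁ :^ 2 :+ (x₂ :^ 2 :+ (x₃ :^ 2 :+ :- a :* x₀ :^ 2)) :+ a :* x₀ :* x₀)
               refl α (x zero) (x (suc zero)) (x (suc (suc zero))) (x (suc (suc (suc zero)))))
        (+-≈0 F₁[x]≈0 (*-≈0ʳ _ x₀≈0))

      Σy²≈0 : y zero ^ 2 + y (suc zero) ^ 2 + y (suc (suc zero)) ^ 2 ≈ 0#
      Σy²≈0 = trans
        (solve 5 (λ b x₀ x₁ x₂ x₃ → (x₁ :^ 2) :^ 2 :+ (x₂ :^ 2) :^ 2 :+ (x₃ :^ 2) :^ 2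
                                   := x₁ :^ 4 :+ (x₂ :^ 4 :+ (x₃ :^ 4 :+ :- b :* x₀ :^ 4)) :+ b :* x₀ :^ 3 :* x₀)
               refl β (x zero) (x (suc zero)) (x (suc (suc zero))) (x (suc (suc (suc zero)))))
        (+-≈0 F₂[x]≈0 (*-≈0ʳ _ x₀≈0))

      pair : ∀ j k → y j * y k * (y k - y j) ≈ 0#
      pair j k = trans
        (solve 2 (λ xⱼ xₖ → xⱼ :^ 2 :* xₖ :^ 2 :* (xₖ :^ 2 :- xⱼ :^ 2) := xⱼ :* xₖ :* (xⱼ :* xₖ :* (xₖ :^ 2 :- xⱼ :^ 2)))
               refl (x (suc j)) (x (suc k)))
        (*-≈0ʳ _ (cancel₈ (trans (sym (minor-at-infinity α β x j k)) (minors≈0 (suc j) (suc k)))))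

      y⁴≈0 : y zero ^ 4 ≈ 0# × y (suc zero) ^ 4 ≈ 0# × y (suc (suc zero)) ^ 4 ≈ 0#
      y⁴≈0 = fourth-powers-vanish isField charZero Σy≈0 Σy²≈0
               (pair zero (suc zero)) (pair zero (suc (suc zero))) (pair (suc zero) (suc (suc zero)))

      x⁸≈0 : ∀ k → x (suc k) ^ 8 ≈ 0#
      x⁸≈0 k = trans (solve 1 (λ xₖ → xₖ :^ 8 := (xₖ :^ 2) :^ 4) refl (x (suc k))) (y⁴≈0-at k)
        where
        y⁴≈0-at : ∀ k → y k ^ 4 ≈ 0#
        y⁴≈0-at zero             = proj₁ y⁴≈0
        y⁴≈0-at (suc zero)       = proj₁ (proj₂ y⁴≈0)
        y⁴≈0-at (suc (suc zero)) = proj₂ (proj₂ y⁴≈0)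

  ¬SqInSet⇒nonsingular : IsField R → CharZero R → (∀ x → AlgebraicOverℚ R x) →
                         ∀ {α β} → ¬ α ≈ 0# → ¬ SqInSet R α β → NonsingularSystem R 3 (system R α β)
  ¬SqInSet⇒nonsingular isField charZero algebraic {α} {β} α≉0 ¬sq x x≢0 F[x]≈0 =
    hasRank₂ isField charZero algebraic (jacobian α β x) minors≉0
    where
    minors≉0 : ¬ (∀ j k → minor (jacobian α β x) j k ≈ 0#)
    minors≉0 minors≈0 = ¬¬-excluded-middle λ
      { (yes x₀≈0) → at-infinity⇒¬¬x≈0 x₀≈0 x≢0
      ; (no x₀≉0)  → affine⇒¬¬SqInSet α≉0 x₀≉0 ¬sq
      }
      where open Singular isField charZero x (F[x]≈0 zero) (F[x]≈0 (suc zero)) minors≈0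

  square-root : AlgebraicallyClosed R → ∀ {β} → ¬ β ≈ 0# → ∀ α → ∃ λ x → β * x ^ 2 ≈ α
  square-root closed {β} β≉0 α with closed (- α) (0# ∷ List.[]) β β≉0
  ... | x , p[x]≈0 = x , x∙y⁻¹≈ε⇒x≈y _ α (trans
    (solve 3 (λ a b x → b :* x :^ 2 :- a := :- a :+ x :* (κ 0 :+ x :* (b :+ x :* κ 0))) refl α β x) p[x]≈0)

  SqInSet⇒idempotents : ∀ {α β} → SqInSet R α β →
    ∃ λ ε₂ → ∃ λ ε₃ → ε₂ * ε₂ ≈ ε₂ × ε₃ * ε₃ ≈ ε₃ × α * α ≈ (1# + ε₂ + ε₃) * β
  SqInSet⇒idempotents {β = β} (inj₁ α²≈β) = 0# , 0# , zeroˡ 0# , zeroˡ 0# ,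
    trans α²≈β (solve 1 (λ b → b := (κ 1 :+ κ 0 :+ κ 0) :* b) refl β)
  SqInSet⇒idempotents {β = β} (inj₂ (inj₁ α²≈2β)) = 1# , 0# , *-identityˡ 1# , zeroˡ 0# ,
    trans α²≈2β (solve 1 (λ b → (κ 1 :+ (κ 1 :+ κ 0)) :* b := (κ 1 :+ κ 1 :+ κ 0) :* b) refl β)
  SqInSet⇒idempotents {β = β} (inj₂ (inj₂ α²≈3β)) = 1# , 1# , *-identityˡ 1# , *-identityˡ 1# ,
    trans α²≈3β (solve 1 (λ b → (κ 1 :+ (κ 1 :+ (κ 1 :+ κ 0))) :* b := (κ 1 :+ κ 1 :+ κ 1) :* b) refl β)

  module SingularPoint {α β x₀ ε₂ ε₃ : K} (ε₂²≈ε₂ : ε₂ * ε₂ ≈ ε₂) (ε₃²≈ε₃ : ε₃ * ε₃ ≈ ε₃)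
                       (βx₀²≈α : β * x₀ ^ 2 ≈ α) (αx₀²≈1+ε₂+ε₃ : α * x₀ ^ 2 ≈ 1# + ε₂ + ε₃) where

    point : Fin 4 → K
    point zero                   = x₀
    point (suc zero)             = 1#
    point (suc (suc zero))       = ε₂
    point (suc (suc (suc zero))) = ε₃

    point^[1+n] : ∀ n k → point (suc k) ^ suc n ≈ point (suc k)
    point^[1+n] n zero             = idempotent-^ (*-identityˡ 1#) n
    point^[1+n] n (suc zero)       = idempotent-^ ε₂²≈ε₂ n
    point^[1+n] n (suc (suc zero)) = idempotent-^ ε₃²≈ε₃ n

    point-on-system : ∀ i → eval R (system R α β i) point ≈ 0#
    point-on-system zero = begin
      eval R (F₁ R α) point
        ≈⟨ +-cong (point^[1+n] 1 zero) (+-cong (point^[1+n] 1 (suc zero)) (+-congʳ (point^[1+n] 1 (suc (suc zero))))) ⟩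
      1# + (ε₂ + (ε₃ + - α * x₀ ^ 2))
        ≈⟨ solve 4 (λ a x₀ ε₂ ε₃ → κ 1 :+ (ε₂ :+ (ε₃ :+ :- a :* x₀ :^ 2)) := κ 1 :+ ε₂ :+ ε₃ :- a :* x₀ :^ 2)
                 refl α x₀ ε₂ ε₃ ⟩
      1# + ε₂ + ε₃ - α * x₀ ^ 2
        ≈⟨ x≈y⇒x∙y⁻¹≈ε (sym αx₀²≈1+ε₂+ε₃) ⟩
      0# ∎
    point-on-system (suc zero) = begin
      eval R (F₂ R β) point
        ≈⟨ +-cong (point^[1+n] 3 zero) (+-cong (point^[1+n] 3 (suc zero)) (+-congʳ (point^[1+n] 3 (suc (suc zero))))) ⟩
      1# + (ε₂ + (ε₃ + - β * x₀ ^ 4))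
        ≈⟨ solve 5 (λ a b x₀ ε₂ ε₃ → κ 1 :+ (ε₂ :+ (ε₃ :+ :- b :* x₀ :^ 4))
                                    := κ 1 :+ ε₂ :+ ε₃ :- a :* x₀ :^ 2 :+ x₀ :^ 2 :* (a :- b :* x₀ :^ 2))
                 refl α β x₀ ε₂ ε₃ ⟩
      1# + ε₂ + ε₃ - α * x₀ ^ 2 + x₀ ^ 2 * (α - β * x₀ ^ 2)
        ≈⟨ +-≈0 (x≈y⇒x∙y⁻¹≈ε (sym αx₀²≈1+ε₂+ε₃)) (*-≈0ʳ _ (x≈y⇒x∙y⁻¹≈ε (sym βx₀²≈α))) ⟩
      0# ∎

    dependence : Fin 2 → K
    dependence zero       = fromℕ 2
    dependence (suc zero) = - 1#

    gradients-dependent : ∀ j → ΣFin R (λ i → dependence i * jacobian α β point i j) ≈ 0#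
    gradients-dependent j = trans
      (+-cong (*-congˡ (jacobian≈gradient α β point zero j))
              (+-congʳ (*-congˡ (jacobian≈gradient α β point (suc zero) j))))
      (combination j)
      where
      combination : ∀ j → fromℕ 2 * gradient α β point zero j + (- 1# * gradient α β point (suc zero) j + 0#) ≈ 0#
      combination zero = trans
        (solve 3 (λ a b x₀ → κ 2 :* (κ 2 :* (:- a :* x₀ :^ 1)) :+ (:- κ 1 :* (κ 4 :* (:- b :* x₀ :^ 3)) :+ κ 0)
                            := κ 4 :* x₀ :* (b :* x₀ :^ 2 :- a))
               refl α β x₀)
        (*-≈0ʳ _ (x≈y⇒x∙y⁻¹≈ε βx₀²≈α))
      combination (suc k) = trans
        (solve 1 (λ ε → κ 2 :* (κ 2 :* (κ 1 :* ε :^ 1)) :+ (:- κ 1 :* (κ 4 :* (κ 1 :* ε :^ 3)) :+ κ 0)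
                      := κ 4 :* (ε :- ε :^ 3))
               refl (point (suc k)))
        (*-≈0ʳ _ (x≈y⇒x∙y⁻¹≈ε (sym (point^[1+n] 2 k))))

  nonsingular⇒¬SqInSet : IsField R → CharZero R → AlgebraicallyClosed R →
                         ∀ {α β} → ¬ β ≈ 0# → NonsingularSystem R 3 (system R α β) → ¬ SqInSet R α β
  nonsingular⇒¬SqInSet isField charZero closed {α} {β} β≉0 nonsingular sq
    with SqInSet⇒idempotents sq | square-root closed β≉0 α
  ... | ε₂ , ε₃ , ε₂²≈ε₂ , ε₃²≈ε₃ , α²≈[1+ε₂+ε₃]β | x₀ , βx₀²≈α =
    fromℕ[1+n]≉0 isField charZero 1
      (nonsingular point point≢0 point-on-system dependence gradients-dependent zero)
    where
    αx₀²≈1+ε₂+ε₃ : α * x₀ ^ 2 ≈ 1# + ε₂ + ε₃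
    αx₀²≈1+ε₂+ε₃ = x∙y⁻¹≈ε⇒x≈y _ _ (x≉0∧xy≈0⇒y≈0 isField β≉0 (begin
      β * (α * x₀ ^ 2 - (1# + ε₂ + ε₃))
        ≈⟨ solve 4 (λ a b x₀ n → b :* (a :* x₀ :^ 2 :- n) := a :* (b :* x₀ :^ 2) :- n :* b)
                 refl α β x₀ (1# + ε₂ + ε₃) ⟩
      α * (β * x₀ ^ 2) - (1# + ε₂ + ε₃) * β
        ≈⟨ +-congʳ (*-congˡ βx₀²≈α) ⟩
      α * α - (1# + ε₂ + ε₃) * β
        ≈⟨ x≈y⇒x∙y⁻¹≈ε α²≈[1+ε₂+ε₃]β ⟩
      0# ∎))

    open SingularPoint ε₂²≈ε₂ ε₃²≈ε₃ βx₀²≈α αx₀²≈1+ε₂+ε₃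

    point≢0 : ¬ (∀ j → point j ≈ 0#)
    point≢0 point≈0 = proj₁ isField (point≈0 (suc zero))

lemma4p1 : ∀ {c ℓ} (R : CommutativeRing c ℓ) → IsAlgebraicClosureOfℚ R →
    (α β : CommutativeRing.Carrier R) → Nonzero R α → Nonzero R β →
    (NonsingularSystem R 3 (system R α β) ⇔ (¬ SqInSet R α β))
lemma4p1 R closure α β α≉0 β≉0 = mk⇔
  (nonsingular⇒¬SqInSet R isField charZero algClosed β≉0)
  (¬SqInSet⇒nonsingular R isField charZero algebraic α≉0)
  where open IsAlgebraicClosureOfℚ closure
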